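{- Let $k\in\mathbb{Z}$ and $i,j,n\in\mathbb{Z}^+$. Then $\chi_{n,k}(K_{i,j})$ exists if and only if $\gcd(ij-1,n)\mid(j-1)k$, and in that case $\chi_{n,k}(K_{i,j})=2$. Moreover, the condition $\gcd(ij-1,n)\mid(j-1)k$ is equivalent to $\gcd(ij-1,n)\mid(i-1)k$.
   Context: $K_{i,j}$ is the complete bipartite graph with parts of sizes $i$ and $j$. For a graph $G=(V,E)$, a labeling $\ell:V\to\mathbb{Z}$ is proper if adjacent vertices get distinct labels, its order is the size of its image, and it is a closed coloring with remainder $k\bmod n$ if $\sum_{w\in N[v]}\ell(w)\equiv k\pmod n$ for every $v$, where $N[v]$ is the closed neighborhood of $v$. $\chi_{n,k}(G)$ exists iff a proper closed coloring with remainder $k\bmod n$ exists, and then is the minimum order of such a coloring. -}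

module Defs where

open import Data.Nat as ℕ using (ℕ; zero; suc; _<ᵇ_; _≤_)
open import Data.Bool using (Bool; true; false; _xor_; _∨_; if_then_else_)
open import Data.Fin using (Fin; toℕ; _≟_)
import Data.Fin as Fin
open import Data.Integer as ℤ using (ℤ; +_; _-_)
open import Data.Integer.Divisibility using (_∣_)
open import Data.Product using (Σ; ∃; _×_; _,_)
open import Relation.Nullary using (¬_; does)
open import Relation.Binary.PropositionalEquality using (_≡_; _≢_)
open import Function.Definitions using (Injective)

record Graph : Set where
  field
    size  : ℕ
    adj   : Fin size → Fin size → Bool
    sym   : ∀ u v → adj u v ≡ adj v u
    irrefl : ∀ v → adj v v ≡ false
open Graph public

sumFin : (m : ℕ) → (Fin m → ℤ) → ℤ
sumFin zero    f = + 0
sumFin (suc m) f = f Fin.zero ℤ.+ sumFin m (λ x → f (Fin.suc x))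

inClosedNbhd : (G : Graph) → Fin (size G) → Fin (size G) → Bool
inClosedNbhd G v w = does (w ≟ v) ∨ adj G v w

closedSum : (G : Graph) → (Fin (size G) → ℤ) → Fin (size G) → ℤ
closedSum G ℓ v = sumFin (size G) (λ w → if inClosedNbhd G v w then ℓ w else + 0)

Labeling : Graph → Set
Labeling G = Fin (size G) → ℤ

Proper : (G : Graph) → Labeling G → Set
Proper G ℓ = ∀ u v → adj G u v ≡ true → ℓ u ≢ ℓ v

_≡_[mod_] : ℤ → ℤ → ℕ → Set
a ≡ b [mod n ] = (+ n) ∣ (a - b)

ClosedColoring : (G : Graph) → (n : ℕ) → (k : ℤ) → Labeling G → Set
ClosedColoring G n k ℓ = ∀ v → closedSum G ℓ v ≡ k [mod n ]

-- the image of ℓ has exactly c elements: it is in bijection with Fin c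
HasOrder : (G : Graph) → Labeling G → ℕ → Set
HasOrder G ℓ c =
  Σ (Fin c → ℤ) λ g → Injective _≡_ _≡_ g
    × (∀ v → ∃ λ t → ℓ v ≡ g t)
    × (∀ t → ∃ λ v → g t ≡ ℓ v)

ProperClosed : (G : Graph) → ℕ → ℤ → Labeling G → Set
ProperClosed G n k ℓ = Proper G ℓ × ClosedColoring G n k ℓ

ChiExists : Graph → ℕ → ℤ → Set
ChiExists G n k = ∃ λ ℓ → ProperClosed G n k ℓ

ChiEq : Graph → ℕ → ℤ → ℕ → Set
ChiEq G n k c =
  (∃ λ ℓ → ProperClosed G n k ℓ × HasOrder G ℓ c)
  × (∀ ℓ c' → ProperClosed G n k ℓ → HasOrder G ℓ c' → c ≤ c')

-- K_{i,j}: vertices Fin (i + j); vertex v is in the first part iff toℕ v < i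
inFirst : (i : ℕ) → {m : ℕ} → Fin m → Bool
inFirst i v = toℕ v <ᵇ i

private
  xor-self : ∀ b → (b xor b) ≡ false
  xor-self false = Relation.Binary.PropositionalEquality.refl
  xor-self true  = Relation.Binary.PropositionalEquality.refl
  xor-comm : ∀ a b → (a xor b) ≡ (b xor a)
  xor-comm false false = Relation.Binary.PropositionalEquality.refl
  xor-comm false true  = Relation.Binary.PropositionalEquality.refl
  xor-comm true  false = Relation.Binary.PropositionalEquality.refl
  xor-comm true  true  = Relation.Binary.PropositionalEquality.refl

K : ℕ → ℕ → Graph
K i j = record
  { size = i ℕ.+ j
  ; adj = λ u v → inFirst i u xor inFirst i v
  ; sym = λ u v → xor-comm (inFirst i u) (inFirst i v)
  ; irrefl = λ v → xor-self (inFirst i v)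
  }

-- A closed colouring of K i j is constant modulo n on each part: two vertices of the same part
-- have the same open neighbourhood, so their closed sums differ exactly by their labels. Writing
-- a and b for the two part labels, closedness is the linear system
--   a + j b ≡ k,   b + i a ≡ k   (mod n),
-- and eliminating b gives (ij − 1) a ≡ (j − 1) k, which is solvable iff gcd(ij − 1, n) divides
-- (j − 1) k. A solution can always be made to have a ≢ b by adding n to a, so two labels suffice,
-- and two are needed as soon as there is an edge. The symmetric condition with i − 1 follows from
-- (i − 1) k = (ij − 1) k − i (j − 1) k.
module Submission where

open import Defs hiding (sym)
open import Data.Nat using (ℕ; _*_; _∸_; NonZero)
open import Data.Nat.GCD using (gcd)
open import Data.Integer using (ℤ; +_)
import Data.Integer as ℤ
open import Data.Integer.Divisibility using (_∣_)
open import Data.Product using (_×_)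
open import Function.Bundles using (_⇔_)

import Data.Nat as ℕ
import Data.Nat.GCD as ℕ
open import Data.Nat using (zero; suc; _≤_; s≤s; z≤n)
open import Data.Bool using (Bool; true; false; not; _xor_; _∨_; if_then_else_)
open import Data.Bool.Properties using (not-injective)
open import Data.Fin using (Fin; zero; suc; _↑ʳ_; _≟_)
open import Data.Integer using (_+_; _-_; -_)
open import Data.Integer.Properties
  using (+-identityˡ; +-identityʳ; +-inverseʳ; *-comm; suc-*; pos-*; neg-distribˡ-*)
  renaming (_≟_ to _≟ℤ_)
open import Data.Integer.Divisibility.Signed
  using (divides; ∣ᵤ⇒∣; ∣⇒∣ᵤ; ∣-refl; ∣-trans; ∣m∣n⇒∣m+n; ∣m∣n⇒∣m-n; ∣m⇒∣-m; ∣m⇒∣m*n; ∣n⇒∣m*n)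
  renaming (_∣_ to _∣ₛ_)
open import Data.Integer.Tactic.RingSolver using (solve-∀)
open import Data.Product using (∃; ∃₂; _,_)
open import Data.Empty using (⊥-elim)
open import Data.Vec.Functional using ([]; _∷_)
open import Function.Base using (_∘_)
open import Function.Definitions using (Injective)
open import Function.Bundles using (mk⇔)
open import Relation.Nullary using (does; yes; no)
open import Relation.Binary.PropositionalEquality
  using (_≡_; _≢_; refl; sym; trans; cong; cong₂; subst; module ≡-Reasoning)

sumOver : ∀ {m} → (Fin m → Bool) → (Fin m → ℤ) → ℤ
sumOver {m} p f = sumFin m (λ w → if p w then f w else + 0)

sumFin-cong : ∀ m {f g : Fin m → ℤ} → (∀ w → f w ≡ g w) → sumFin m f ≡ sumFin m g
sumFin-cong zero    f≗g = refl
sumFin-cong (suc m) f≗g = cong₂ _+_ (f≗g zero) (sumFin-cong m (f≗g ∘ suc))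

sumFin-zero : ∀ m → sumFin m (λ _ → + 0) ≡ + 0
sumFin-zero zero    = refl
sumFin-zero (suc m) = trans (+-identityˡ _) (sumFin-zero m)

sumFin-const : ∀ m x → sumFin m (λ _ → x) ≡ + m ℤ.* x
sumFin-const zero    x = refl
sumFin-const (suc m) x = trans (cong (_+_ x) (sumFin-const m x)) (sym (suc-* (+ m) x))

sumFin-+ : ∀ m (f g : Fin m → ℤ) → sumFin m (λ w → f w + g w) ≡ sumFin m f + sumFin m g
sumFin-+ zero    f g = refl
sumFin-+ (suc m) f g =
  trans (cong (_+_ (f zero + g zero)) (sumFin-+ m (f ∘ suc) (g ∘ suc)))
        (interchange (f zero) (g zero) (sumFin m (f ∘ suc)) (sumFin m (g ∘ suc)))
  where
  interchange : ∀ a b c d → (a + b) + (c + d) ≡ (a + c) + (b + d)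
  interchange = solve-∀

sumFin-single : ∀ {m} (f : Fin m → ℤ) v → sumFin m (λ w → if does (w ≟ v) then f w else + 0) ≡ f v
sumFin-single {suc m} f zero =
  trans (cong (_+_ (f zero)) (sumFin-zero m)) (+-identityʳ (f zero))
sumFin-single {suc m} f (suc v) = trans (+-identityˡ _) (sumFin-single (f ∘ suc) v)

sumFin-∣-cong : ∀ {d} m (f g : Fin m → ℤ) → (∀ w → d ∣ₛ f w - g w) → d ∣ₛ sumFin m f - sumFin m g
sumFin-∣-cong zero    f g d∣ = divides (+ 0) refl
sumFin-∣-cong (suc m) f g d∣ =
  subst (_ ∣ₛ_) (regroup (f zero) (g zero) _ _)
        (∣m∣n⇒∣m+n (d∣ zero) (sumFin-∣-cong m (f ∘ suc) (g ∘ suc) (d∣ ∘ suc)))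
  where
  regroup : ∀ a b c e → (a - b) + (c - e) ≡ (a + c) - (b + e)
  regroup = solve-∀

sumOver-∣-const : ∀ {d m} (p : Fin m → Bool) (f : Fin m → ℤ) x →
  (∀ w → p w ≡ true → d ∣ₛ f w - x) → d ∣ₛ sumOver p f - sumOver p (λ _ → x)
sumOver-∣-const {m = m} p f x d∣ = sumFin-∣-cong m _ _ pointwise
  where
  pointwise : ∀ w → _ ∣ₛ (if p w then f w else + 0) - (if p w then x else + 0)
  pointwise w with p w in pw
  ... | true  = d∣ w pw
  ... | false = divides (+ 0) refl

openSum : (G : Graph) → Labeling G → Fin (size G) → ℤ
openSum G ℓ v = sumOver (adj G v) ℓ

closedSum≡label+openSum : ∀ G ℓ v → closedSum G ℓ v ≡ ℓ v + openSum G ℓ v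
closedSum≡label+openSum G ℓ v = begin
  closedSum G ℓ v
    ≡⟨ sumFin-cong (size G) split ⟩
  sumFin (size G) (λ w → (if does (w ≟ v) then ℓ w else + 0) + (if adj G v w then ℓ w else + 0))
    ≡⟨ sumFin-+ (size G) _ _ ⟩
  sumFin (size G) (λ w → if does (w ≟ v) then ℓ w else + 0) + openSum G ℓ v
    ≡⟨ cong (_+ openSum G ℓ v) (sumFin-single ℓ v) ⟩
  ℓ v + openSum G ℓ v ∎
  where
  open ≡-Reasoning
  split : ∀ w → (if does (w ≟ v) ∨ adj G v w then ℓ w else + 0)
              ≡ (if does (w ≟ v) then ℓ w else + 0) + (if adj G v w then ℓ w else + 0)
  split w with w ≟ v
  ... | yes refl rewrite irrefl G w = sym (+-identityʳ (ℓ w))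
  ... | no _ = sym (+-identityˡ _)

closed⇒label+openSum≡k[mod] : ∀ {G n k ℓ} → ClosedColoring G n k ℓ →
  ∀ v → + n ∣ₛ ℓ v + openSum G ℓ v - k
closed⇒label+openSum≡k[mod] {G} {n} {k} {ℓ} closed v =
  subst (λ s → + n ∣ₛ s - k) (closedSum≡label+openSum G ℓ v) (∣ᵤ⇒∣ (closed v))

openSum≡⇒label≡[mod] : ∀ {G n k ℓ} → ClosedColoring G n k ℓ →
  ∀ {u v} → openSum G ℓ u ≡ openSum G ℓ v → + n ∣ₛ ℓ u - ℓ v
openSum≡⇒label≡[mod] {G} {n} {k} {ℓ} closed {u} {v} same =
  subst (+ n ∣ₛ_) (cancel (ℓ u) (ℓ v) (openSum G ℓ u) k)
        (∣m∣n⇒∣m-n (closedAt u) (subst (λ s → + n ∣ₛ ℓ v + s - k) (sym same) (closedAt v)))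
  where
  closedAt : ∀ v → + n ∣ₛ ℓ v + openSum G ℓ v - k
  closedAt = closed⇒label+openSum≡k[mod] {G} {ℓ = ℓ} closed
  cancel : ∀ a b s k → (a + s - k) - (b + s - k) ≡ a - b
  cancel = solve-∀

proper⇒order≥2 : ∀ {G ℓ c u v} → Proper G ℓ → adj G u v ≡ true → HasOrder G ℓ c → 2 ≤ c
proper⇒order≥2 {u = u} {v} proper uv (_ , _ , image , _) with image u | image v
proper⇒order≥2 {c = zero} _ _ _ | () , _ | _
proper⇒order≥2 {c = 1} proper uv _ | zero , ℓu≡g0 | zero , ℓv≡g0 =
  ⊥-elim (proper _ _ uv (trans ℓu≡g0 (sym ℓv≡g0)))
proper⇒order≥2 {c = suc (suc _)} _ _ _ | _ | _ = s≤s (s≤s z≤n)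

inFirst-↑ʳ : ∀ i {j} (w : Fin j) → inFirst i (i ↑ʳ w) ≡ false
inFirst-↑ʳ zero    w = refl
inFirst-↑ʳ (suc i) w = inFirst-↑ʳ i w

K-edge : ∀ i j → adj (K (suc i) (suc j)) zero (suc i ↑ʳ zero) ≡ true
K-edge i j = cong not (inFirst-↑ʳ (suc i) zero)

module CompleteBipartite (i j : ℕ) where

  firstSum secondSum : Labeling (K i j) → ℤ
  firstSum  ℓ = sumOver (inFirst i) ℓ
  secondSum ℓ = sumOver (not ∘ inFirst i) ℓ

  openSum-sameSide : ∀ ℓ u v → inFirst i u ≡ inFirst i v → openSum (K i j) ℓ u ≡ openSum (K i j) ℓ v
  openSum-sameSide ℓ u v same = cong (λ s → sumOver (λ w → s xor inFirst i w) ℓ) same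

  openSum-first : ∀ ℓ v → inFirst i v ≡ true → openSum (K i j) ℓ v ≡ secondSum ℓ
  openSum-first ℓ v first = cong (λ s → sumOver (λ w → s xor inFirst i w) ℓ) first

  openSum-second : ∀ ℓ v → inFirst i v ≡ false → openSum (K i j) ℓ v ≡ firstSum ℓ
  openSum-second ℓ v second = cong (λ s → sumOver (λ w → s xor inFirst i w) ℓ) second

  firstSum-const : ∀ x → firstSum (λ _ → x) ≡ + i ℤ.* x
  firstSum-const x = count i
    where
    count : ∀ i → sumOver {i ℕ.+ j} (inFirst i) (λ _ → x) ≡ + i ℤ.* x
    count zero    = sumFin-zero j
    count (suc i) = trans (cong (_+_ x) (count i)) (sym (suc-* (+ i) x))

  secondSum-const : ∀ x → secondSum (λ _ → x) ≡ + j ℤ.* x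
  secondSum-const x = count i
    where
    count : ∀ i → sumOver {i ℕ.+ j} (not ∘ inFirst i) (λ _ → x) ≡ + j ℤ.* x
    count zero    = sumFin-const j x
    count (suc i) = trans (+-identityˡ _) (count i)

  twoLabel : ℤ → ℤ → Labeling (K i j)
  twoLabel a b w = if inFirst i w then a else b

  firstSum-twoLabel : ∀ a b → firstSum (twoLabel a b) ≡ + i ℤ.* a
  firstSum-twoLabel a b = trans (sumFin-cong (i ℕ.+ j) select) (firstSum-const a)
    where
    select : ∀ w → (if inFirst i w then (if inFirst i w then a else b) else + 0)
                 ≡ (if inFirst i w then a else + 0)
    select w with inFirst i w
    ... | true  = refl
    ... | false = refl

  secondSum-twoLabel : ∀ a b → secondSum (twoLabel a b) ≡ + j ℤ.* b
  secondSum-twoLabel a b = trans (sumFin-cong (i ℕ.+ j) select) (secondSum-const b)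
    where
    select : ∀ w → (if not (inFirst i w) then (if inFirst i w then a else b) else + 0)
                 ≡ (if not (inFirst i w) then b else + 0)
    select w with inFirst i w
    ... | true  = refl
    ... | false = refl

  closedSum-twoLabel : ∀ a b v →
    closedSum (K i j) (twoLabel a b) v ≡ (if inFirst i v then a + + j ℤ.* b else b + + i ℤ.* a)
  closedSum-twoLabel a b v = bySide (inFirst i v) refl
    where
    ℓ : Labeling (K i j)
    ℓ = twoLabel a b
    bySide : ∀ s → inFirst i v ≡ s →
      closedSum (K i j) ℓ v ≡ (if s then a + + j ℤ.* b else b + + i ℤ.* a)
    bySide true side =
      trans (closedSum≡label+openSum (K i j) ℓ v)
            (cong₂ _+_ (cong (λ s → if s then a else b) side)
                       (trans (openSum-first ℓ v side) (secondSum-twoLabel a b)))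
    bySide false side =
      trans (closedSum≡label+openSum (K i j) ℓ v)
            (cong₂ _+_ (cong (λ s → if s then a else b) side)
                       (trans (openSum-second ℓ v side) (firstSum-twoLabel a b)))

  twoLabel-proper : ∀ {a b} → a ≢ b → Proper (K i j) (twoLabel a b)
  twoLabel-proper a≢b u v adjacent with inFirst i u | inFirst i v
  ... | true  | false = a≢b
  ... | false | true  = a≢b ∘ sym
  twoLabel-proper a≢b u v () | true  | true
  twoLabel-proper a≢b u v () | false | false

record ClosedPair (n : ℕ) (k i j a b : ℤ) : Set where
  constructor closedPair
  field
    atFirst  : + n ∣ₛ a + j ℤ.* b - k
    atSecond : + n ∣ₛ b + i ℤ.* a - k

closed⇒closedPair : ∀ {i j n k} {ℓ : Labeling (K (suc i) (suc j))} →
  ClosedColoring (K (suc i) (suc j)) n k ℓ →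
  ClosedPair n k (+ suc i) (+ suc j) (ℓ zero) (ℓ (suc i ↑ʳ zero))
closed⇒closedPair {i} {j} {n} {k} {ℓ} closed = closedPair
  (replace a (secondSum ℓ) (+ suc j ℤ.* b) atFirst sumSecond)
  (replace b (firstSum ℓ) (+ suc i ℤ.* a) atSecond sumFirst)
  where
  open CompleteBipartite (suc i) (suc j)
  G : Graph
  G = K (suc i) (suc j)
  a b : ℤ
  a = ℓ zero
  b = ℓ (suc i ↑ʳ zero)
  secondVertex : inFirst (suc i) (suc i ↑ʳ zero) ≡ false
  secondVertex = inFirst-↑ʳ (suc i) zero
  atFirst : + n ∣ₛ a + secondSum ℓ - k
  atFirst = subst (λ s → + n ∣ₛ a + s - k) (openSum-first ℓ zero refl)
                  (closed⇒label+openSum≡k[mod] {G} {ℓ = ℓ} closed zero)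
  atSecond : + n ∣ₛ b + firstSum ℓ - k
  atSecond = subst (λ s → + n ∣ₛ b + s - k) (openSum-second ℓ (suc i ↑ʳ zero) secondVertex)
                   (closed⇒label+openSum≡k[mod] {G} {ℓ = ℓ} closed (suc i ↑ʳ zero))
  sameAsA : ∀ w → inFirst (suc i) w ≡ true → + n ∣ₛ ℓ w - a
  sameAsA w first = openSum≡⇒label≡[mod] {G} {ℓ = ℓ} closed (openSum-sameSide ℓ w zero first)
  sameAsB : ∀ w → not (inFirst (suc i) w) ≡ true → + n ∣ₛ ℓ w - b
  sameAsB w second = openSum≡⇒label≡[mod] {G} {ℓ = ℓ} closed
    (openSum-sameSide ℓ w (suc i ↑ʳ zero) (trans (not-injective second) (sym secondVertex)))
  sumFirst : + n ∣ₛ firstSum ℓ - + suc i ℤ.* a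
  sumFirst = subst (λ t → + n ∣ₛ firstSum ℓ - t) (firstSum-const a) (sumOver-∣-const _ ℓ a sameAsA)
  sumSecond : + n ∣ₛ secondSum ℓ - + suc j ℤ.* b
  sumSecond = subst (λ t → + n ∣ₛ secondSum ℓ - t) (secondSum-const b)
                    (sumOver-∣-const _ ℓ b sameAsB)
  replace : ∀ x s c → + n ∣ₛ x + s - k → + n ∣ₛ s - c → + n ∣ₛ x + c - k
  replace x s c h s≡c = subst (+ n ∣ₛ_) (shift x s c k) (∣m∣n⇒∣m-n h s≡c)
    where
    shift : ∀ x s c k → (x + s - k) - (s - c) ≡ x + c - k
    shift = solve-∀

twoLabel-closed : ∀ {i j n k a b} → ClosedPair n k (+ i) (+ j) a b →
  ClosedColoring (K i j) n k (CompleteBipartite.twoLabel i j a b)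
twoLabel-closed {i} {j} {n} {k} {a} {b} (closedPair first second) v =
  ∣⇒∣ᵤ (subst (λ s → + n ∣ₛ s - k) (sym (closedSum-twoLabel a b v)) (bySide (inFirst i v)))
  where
  open CompleteBipartite i j
  bySide : ∀ s → + n ∣ₛ (if s then a + + j ℤ.* b else b + + i ℤ.* a) - k
  bySide true  = first
  bySide false = second

twoLabel-hasOrder2 : ∀ {i j a b} → a ≢ b →
  HasOrder (K (suc i) (suc j)) (CompleteBipartite.twoLabel (suc i) (suc j) a b) 2
twoLabel-hasOrder2 {i} {j} {a} {b} a≢b = labels , injective , covered , attained
  where
  labels : Fin 2 → ℤ
  labels = a ∷ b ∷ []
  injective : Injective _≡_ _≡_ labels
  injective {zero}     {zero}     _   = refl
  injective {zero}     {suc zero} a≡b = ⊥-elim (a≢b a≡b)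
  injective {suc zero} {zero}     b≡a = ⊥-elim (a≢b (sym b≡a))
  injective {suc zero} {suc zero} _   = refl
  covered : ∀ v → ∃ λ t → (if inFirst (suc i) v then a else b) ≡ labels t
  covered v with inFirst (suc i) v
  ... | true  = zero , refl
  ... | false = suc zero , refl
  attained : ∀ t → ∃ λ v → labels t ≡ (if inFirst (suc i) v then a else b)
  attained zero       = zero , refl
  attained (suc zero) =
    suc i ↑ʳ zero , cong (λ s → if s then a else b) (sym (inFirst-↑ʳ (suc i) zero))

closedPair⇒χ≡2 : ∀ {i j n k} → (∃₂ λ a b → a ≢ b × ClosedPair n k (+ suc i) (+ suc j) a b) →
  ChiEq (K (suc i) (suc j)) n k 2
closedPair⇒χ≡2 {i} {j} (a , b , a≢b , pair) =
    (twoLabel a b , (twoLabel-proper a≢b , twoLabel-closed {suc i} {suc j} pair) , twoLabel-hasOrder2 a≢b)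
  , λ ℓ c (proper , _) →
      proper⇒order≥2 {K (suc i) (suc j)} {ℓ} {u = zero} {suc i ↑ʳ zero} proper (K-edge i j)
  where open CompleteBipartite (suc i) (suc j)

i+j-i≡j : ∀ i j → i + j - i ≡ j
i+j-i≡j = solve-∀

closedPair⇒∣ : ∀ {d n k i j a b} → d ∣ₛ + n → d ∣ₛ i ℤ.* j - + 1 → ClosedPair n k i j a b →
  d ∣ₛ (j - + 1) ℤ.* k
closedPair⇒∣ {d} {n} {k} {i} {j} {a} {b} d∣n d∣ij-1 (closedPair first second) =
  subst (d ∣ₛ_) (eliminate i j k a b)
        (∣m∣n⇒∣m-n (∣m⇒∣m*n a d∣ij-1) (∣-trans d∣n (∣m∣n⇒∣m-n (∣n⇒∣m*n j second) first)))
  where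
  eliminate : ∀ i j k a b → (i ℤ.* j - + 1) ℤ.* a - (j ℤ.* (b + i ℤ.* a - k) - (a + j ℤ.* b - k))
                          ≡ (j - + 1) ℤ.* k
  eliminate = solve-∀

∣[j-1]k⇒∣[i-1]k : ∀ {d} i j k → d ∣ₛ i ℤ.* j - + 1 → d ∣ₛ (j - + 1) ℤ.* k → d ∣ₛ (i - + 1) ℤ.* k
∣[j-1]k⇒∣[i-1]k {d} i j k d∣ij-1 d∣[j-1]k =
  subst (d ∣ₛ_) (swap i j k) (∣m∣n⇒∣m-n (∣m⇒∣m*n k d∣ij-1) (∣n⇒∣m*n i d∣[j-1]k))
  where
  swap : ∀ i j k → (i ℤ.* j - + 1) ℤ.* k - i ℤ.* ((j - + 1) ℤ.* k) ≡ (i - + 1) ℤ.* k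
  swap = solve-∀

gcd-bezout : ∀ m n → ∃ λ x → + n ∣ₛ x ℤ.* + m - + gcd m n
gcd-bezout m n = fromIdentity (ℕ.Bézout.identity (ℕ.gcd-GCD m n))
  where
  open ≡-Reasoning
  g : ℕ
  g = gcd m n
  lift : ∀ a b c e → g ℕ.+ a ℕ.* b ≡ c ℕ.* e → + g + + a ℤ.* + b ≡ + c ℤ.* + e
  lift a b c e eq = trans (cong (_+_ (+ g)) (sym (pos-* a b))) (trans (cong +_ eq) (pos-* c e))
  negate : ∀ g x m → - x ℤ.* m - g ≡ - (g + x ℤ.* m)
  negate = solve-∀
  fromIdentity : ℕ.Bézout.Identity g m n → ∃ λ x → + n ∣ₛ x ℤ.* + m - + g
  fromIdentity (ℕ.Bézout.+- x y eq) = + x , divides (+ y) (begin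
    + x ℤ.* + m - + g              ≡⟨ cong (_- + g) (lift y n x m eq) ⟨
    + g + + y ℤ.* + n - + g         ≡⟨ i+j-i≡j (+ g) _ ⟩
    + y ℤ.* + n                     ∎)
  fromIdentity (ℕ.Bézout.-+ x y eq) = - + x , divides (- + y) (begin
    - + x ℤ.* + m - + g            ≡⟨ negate (+ g) (+ x) (+ m) ⟩
    - (+ g + + x ℤ.* + m)           ≡⟨ cong -_ (lift x m y n eq) ⟩
    - (+ y ℤ.* + n)                 ≡⟨ neg-distribˡ-* (+ y) (+ n) ⟩
    - + y ℤ.* + n                   ∎)

closedPair-solvable : ∀ {m} n k i j → + m ≡ i ℤ.* j - + 1 → + gcd m n ∣ₛ (j - + 1) ℤ.* k →
  ∃₂ (ClosedPair n k i j)
closedPair-solvable {m} n k i j m≡ij-1 (divides q [j-1]k≡qg) with gcd-bezout m n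
... | x , n∣xm-g = a , k - i ℤ.* a , closedPair first second
  where
  open ≡-Reasoning
  g : ℕ
  g = gcd m n
  a : ℤ
  a = x ℤ.* q
  expand : ∀ q x m g → - (q ℤ.* (x ℤ.* m - g)) ≡ q ℤ.* g - x ℤ.* q ℤ.* m
  expand = solve-∀
  eliminate : ∀ i j k a → (j - + 1) ℤ.* k - a ℤ.* (i ℤ.* j - + 1) ≡ a + j ℤ.* (k - i ℤ.* a) - k
  eliminate = solve-∀
  first : + n ∣ₛ a + j ℤ.* (k - i ℤ.* a) - k
  first = subst (+ n ∣ₛ_) (begin
    - (q ℤ.* (x ℤ.* + m - + g))             ≡⟨ expand q x (+ m) (+ g) ⟩
    q ℤ.* + g - a ℤ.* + m                     ≡⟨ cong₂ _-_ (sym [j-1]k≡qg) (cong (a ℤ.*_) m≡ij-1) ⟩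
    (j - + 1) ℤ.* k - a ℤ.* (i ℤ.* j - + 1)   ≡⟨ eliminate i j k a ⟩
    a + j ℤ.* (k - i ℤ.* a) - k               ∎)
    (∣m⇒∣-m (∣n⇒∣m*n q n∣xm-g))
  second : + n ∣ₛ (k - i ℤ.* a) + i ℤ.* a - k
  second = subst (+ n ∣ₛ_) (sym (cancel k (i ℤ.* a))) (divides (+ 0) refl)
    where
    cancel : ∀ k c → (k - c) + c - k ≡ + 0
    cancel = solve-∀

closedPair-+n : ∀ {n k i j a b} → ClosedPair n k i j a b → ClosedPair n k i j (a + + n) b
closedPair-+n {n} {k} {i} {j} {a} {b} (closedPair first second) = closedPair
    (subst (+ n ∣ₛ_) (shiftFirst a (j ℤ.* b) k (+ n)) (∣m∣n⇒∣m+n first ∣-refl))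
    (subst (+ n ∣ₛ_) (shiftSecond b i a k (+ n)) (∣m∣n⇒∣m+n second (∣n⇒∣m*n i ∣-refl)))
  where
  shiftFirst : ∀ a c k n → (a + c - k) + n ≡ (a + n) + c - k
  shiftFirst = solve-∀
  shiftSecond : ∀ b i a k n → (b + i ℤ.* a - k) + i ℤ.* n ≡ b + i ℤ.* (a + n) - k
  shiftSecond = solve-∀

closedPair-distinct : ∀ {n k i j} → ∃₂ (ClosedPair (suc n) k i j) →
  ∃₂ λ a b → a ≢ b × ClosedPair (suc n) k i j a b
closedPair-distinct {n} (a , b , pair) with a ≟ℤ b
... | no a≢b  = a , b , a≢b , pair
... | yes refl = a + + suc n , a , a+[1+n]≢a , closedPair-+n pair
  where
  a+[1+n]≢a : a + + suc n ≢ a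
  a+[1+n]≢a eq with trans (sym (i+j-i≡j a (+ suc n))) (trans (cong (_- a) eq) (+-inverseʳ a))
  ... | ()

theorem4p3 : (k : ℤ) (i j n : ℕ) → NonZero i → NonZero j → NonZero n →
    (ChiExists (K i j) n k ⇔ (+ gcd (i * j ∸ 1) n ∣ (+ (j ∸ 1)) ℤ.* k))
    × ((+ gcd (i * j ∸ 1) n ∣ (+ (j ∸ 1)) ℤ.* k) → ChiEq (K i j) n k 2)
    × ((+ gcd (i * j ∸ 1) n ∣ (+ (j ∸ 1)) ℤ.* k) ⇔ (+ gcd (i * j ∸ 1) n ∣ (+ (i ∸ 1)) ℤ.* k))
theorem4p3 k zero _ _ i≢0 _ _ = ⊥-elim (ℕ.NonZero.nonZero i≢0)
theorem4p3 k (suc i) zero _ _ j≢0 _ = ⊥-elim (ℕ.NonZero.nonZero j≢0)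
theorem4p3 k (suc i) (suc j) zero _ _ n≢0 = ⊥-elim (ℕ.NonZero.nonZero n≢0)
theorem4p3 k (suc i) (suc j) (suc n) _ _ _ =
    mk⇔ (λ (ℓ , _ , closed) → unsigned (closedPair⇒∣ d∣n d∣IJ-1 (closed⇒closedPair {ℓ = ℓ} closed)))
        (λ d∣ → let ((ℓ , properClosed , _) , _) = χ≡2 d∣ in ℓ , properClosed)
  , χ≡2
  , mk⇔ (unsigned ∘ ∣[j-1]k⇒∣[i-1]k I J k d∣IJ-1 ∘ signed)
        (unsigned ∘ ∣[j-1]k⇒∣[i-1]k J I k d∣JI-1 ∘ signed)
  where
  I J : ℤ
  I = + suc i
  J = + suc j
  M d : ℕ
  M = suc i * suc j ∸ 1
  d = gcd M (suc n)
  signed : ∀ {x} → + d ∣ x → + d ∣ₛ x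
  signed = ∣ᵤ⇒∣ {+ d}
  unsigned : ∀ {x} → + d ∣ₛ x → + d ∣ x
  unsigned = ∣⇒∣ᵤ {+ d}
  d∣n : + d ∣ₛ + suc n
  d∣n = signed (ℕ.gcd[m,n]∣n M (suc n))
  -- + M reduces to I ℤ.* J - + 1 and + (suc j ∸ 1) to J - + 1, so no ∸ arithmetic is needed.
  d∣IJ-1 : + d ∣ₛ I ℤ.* J - + 1
  d∣IJ-1 = signed (ℕ.gcd[m,n]∣m M (suc n))
  d∣JI-1 : + d ∣ₛ J ℤ.* I - + 1
  d∣JI-1 = subst (λ t → + d ∣ₛ t - + 1) (*-comm I J) d∣IJ-1
  χ≡2 : + d ∣ + j ℤ.* k → ChiEq (K (suc i) (suc j)) (suc n) k 2
  χ≡2 d∣ = closedPair⇒χ≡2 (closedPair-distinct (closedPair-solvable (suc n) k I J refl (signed d∣)))
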